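{- Let $k\in\mathbb{Z}$. For all $x,n\in\mathbb{N}$, $$(-1)^{x-1}E_{n-1}^{(k)}(x)+E_{n-1}^{(k)}=\frac{2}{n}\sum_{m=1}^{n}\sum_{j=1}^{m}\sum_{i=0}^{x-1}(-1)^{i}i^{n-m}\binom{n}{m}\frac{S_{1}(m,j)}{j^{k-1}},$$ with the convention $0^0=1$.
   Context: For $k\in\mathbb{Z}$, $\mathrm{Ei}_k(x)=\sum_{n=1}^{\infty}\frac{x^n}{n^k (n-1)!}$; the poly-Genocchi polynomials $G_n^{(k)}(x)$ are defined by $\frac{2\,\mathrm{Ei}_k(\log(1+t))}{e^t+1}e^{xt}=\sum_{n=0}^{\infty}G_n^{(k)}(x)\frac{t^n}{n!}$; the poly-Euler polynomials are $E_n^{(k)}(x)=\frac{G_{n+1}^{(k)}(x)}{n+1}$ ($n\ge0$), and $E_n^{(k)}=E_n^{(k)}(0)$. $S_1(n,m)$ are the signed Stirling numbers of the first kind: $\frac{(\log(1+t))^m}{m!}=\sum_{n\ge m}S_1(n,m)\frac{t^n}{n!}$. -}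

module Defs where

open import Data.Nat as ℕ using (ℕ; zero; suc; _!)
open import Data.Integer as ℤ using (ℤ; +_; -[1+_])
open import Data.Rational as ℚ using (ℚ; 0ℚ; 1ℚ; _+_; _*_; -_; _-_; _≟_)
open import Data.List using (List; []; _∷_; zipWith; map; foldr; upTo)
open import Relation.Nullary using (yes; no)

sum : List ℚ → ℚ
sum = foldr _+_ 0ℚ

ℕ→ℚ : ℕ → ℚ
ℕ→ℚ n = (+ n) ℚ./ 1

-- total reciprocal (1/0 := 0; only ever used on nonzero arguments)
inv : ℚ → ℚ
inv q with q ≟ 0ℚ
... | yes _  = 0ℚ
... | no q≢0 = ℚ.1/_ q {{ℚ.≢-nonZero q≢0}}

-- natural powers of a rational (q ^ 0 = 1, so 0 ^ 0 = 1)
_^ℕ_ : ℚ → ℕ → ℚ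
q ^ℕ zero  = 1ℚ
q ^ℕ suc n = q * (q ^ℕ n)

_^ℤ_ : ℚ → ℤ → ℚ
q ^ℤ (+ n)    = q ^ℕ n
q ^ℤ -[1+ n ] = inv (q ^ℕ suc n)

sgn : ℕ → ℚ
sgn n = (- 1ℚ) ^ℕ n

-- Σ_{i=a}^{b} f i  (empty when b < a)
sumFromTo : ℕ → ℕ → (ℕ → ℚ) → ℚ
sumFromTo a b f = sum (map (λ i → f (a ℕ.+ i)) (upTo (suc b ℕ.∸ a)))

-- Formal power series over ℚ, as ordinary coefficient sequences:
-- a series f stands for Σ_n f n · t^n.

Series : Set
Series = ℕ → ℚ

_⊛_ : Series → Series → Series
(f ⊛ g) n = sumFromTo 0 n (λ i → f i * g (n ℕ.∸ i))

oneS : Series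
oneS zero    = 1ℚ
oneS (suc _) = 0ℚ

_^S_ : Series → ℕ → Series
f ^S zero  = oneS
f ^S suc m = f ⊛ (f ^S m)

scaleS : ℚ → Series → Series
scaleS c f n = c * f n

-- multiplicative inverse of a series h with h 0 ≠ 0:
-- b 0 = 1 / h 0,  b n = - (1 / h 0) Σ_{i=1}^{n} h i · b (n - i)
-- invList h n = [b n, b (n-1), ..., b 0]
invList : Series → ℕ → List ℚ
invList h zero    = inv (h 0) ∷ []
invList h (suc n) =
  (- (inv (h 0) * sum (zipWith _*_ (map (λ i → h (suc i)) (upTo (suc n))) bs))) ∷ bs
  where bs = invList h n

headOr0 : List ℚ → ℚ
headOr0 []      = 0ℚ
headOr0 (q ∷ _) = q

invS : Series → Series
invS h n = headOr0 (invList h n)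

logS : Series
logS zero    = 0ℚ
logS (suc n) = sgn n * inv (ℕ→ℚ (suc n))

expS : ℚ → Series
expS x n = (x ^ℕ n) * inv (ℕ→ℚ (n !))

expPlusOne : Series
expPlusOne n = expS 1ℚ n + oneS n

-- Ei_k(x) = Σ_{j≥1} x^j / (j^k (j-1)!), composed with log(1+t):
-- Ei_k(log(1+t)) = Σ_{j≥1} (log(1+t))^j / (j^k (j-1)!).
-- Since (log(1+t))^j = O(t^j), the coefficient of t^n only involves j ≤ n.
EiLogS : ℤ → Series
EiLogS k n = sumFromTo 1 n (λ j →
  (logS ^S j) n * inv ((ℕ→ℚ j ^ℤ k) * ℕ→ℚ ((j ℕ.∸ 1) !)))

GenocchiGF : ℤ → ℚ → Series
GenocchiGF k x = (scaleS (ℕ→ℚ 2) (invS expPlusOne) ⊛ EiLogS k) ⊛ expS x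

polyGenocchi : ℤ → ℕ → ℚ → ℚ
polyGenocchi k n x = ℕ→ℚ (n !) * GenocchiGF k x n

polyEuler : ℤ → ℕ → ℚ → ℚ
polyEuler k n x = polyGenocchi k (suc n) x * inv (ℕ→ℚ (suc n))

polyEulerNum : ℤ → ℕ → ℚ
polyEulerNum k n = polyEuler k n 0ℚ

-- signed Stirling numbers of the first kind, via
-- (log(1+t))^m / m! = Σ_n S1(n,m) t^n / n!
S1 : ℕ → ℕ → ℚ
S1 n m = ℕ→ℚ (n !) * inv (ℕ→ℚ (m !)) * (logS ^S m) n

module Submission where

open import Defs
open import Data.Nat using (ℕ; suc; _∸_)
open import Data.Nat.Combinatorics using (_C_)
open import Data.Integer using (ℤ; _-_; +_)
open import Data.Rational using (ℚ; _+_; _*_)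
open import Relation.Binary.PropositionalEquality using (_≡_)

open import Data.Nat as ℕ using (zero; _!; _<_; _≤_; s≤s; z≤n)
import Data.Nat.Properties as ℕₚ
open import Data.Nat.Combinatorics using (nCk≡n!/k![n-k]!; k![n∸k]!∣n!)
open import Data.Nat.DivMod using (m/n*n≡m)
import Data.Nat.Coprimality as Coprimality
open import Data.Integer as ℤ using (-[1+_])
import Data.Integer.Properties as ℤₚ
open import Data.Rational as ℚ using (0ℚ; 1ℚ; -_; mkℚ)
import Data.Rational.Properties as ℚₚ
open import Data.Rational.Solver using (module +-*-Solver)
open import Data.List using ([]; _∷_; map; applyUpTo; upTo; zipWith)
import Data.List.Properties as List
open import Data.Empty using (⊥-elim)
open import Relation.Nullary using (yes; no)
open import Relation.Binary.PropositionalEquality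
  using (_≢_; _≗_; refl; sym; trans; cong; cong₂; _→-setoid_; module ≡-Reasoning)
import Relation.Binary.Reasoning.Setoid as SetoidReasoning

open +-*-Solver

-- Write G(x) = G_n^{(k)}(x). Since e^{(x+1)t} + e^{xt} = e^{xt} (e^t + 1) cancels the denominator
-- of the generating function, G(x+1) + G(x) = 2 n! [t^n] Ei_k(log(1+t)) e^{xt}. Expanding
-- (log(1+t))^j / j! through the Stirling numbers S1(m,j) and e^{xt} as a power series, this is
-- 2 Σ_m Σ_j x^{n-m} C(n,m) S1(m,j) / j^{k-1}. The alternating sum of these identities at
-- i = 0, …, x-1 telescopes to (-1)^{x-1} G(x) + G(0), and dividing by n gives the poly-Euler form.

ℕ→ℚ≡mkℚ : ∀ n → ℕ→ℚ n ≡ mkℚ (+ n) 0 (Coprimality.sym (Coprimality.1-coprimeTo n))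
ℕ→ℚ≡mkℚ n = ℚₚ.normalize-coprime (Coprimality.sym (Coprimality.1-coprimeTo n))

ℕ→ℚ-+ : ∀ m n → ℕ→ℚ (m ℕ.+ n) ≡ ℕ→ℚ m + ℕ→ℚ n
ℕ→ℚ-+ m n rewrite ℕ→ℚ≡mkℚ m | ℕ→ℚ≡mkℚ n =
  sym (cong₂ (λ a b → (a ℤ.+ b) ℚ./ 1) (ℤₚ.*-identityʳ (+ m)) (ℤₚ.*-identityʳ (+ n)))

ℕ→ℚ-* : ∀ m n → ℕ→ℚ (m ℕ.* n) ≡ ℕ→ℚ m * ℕ→ℚ n
ℕ→ℚ-* m n rewrite ℕ→ℚ≡mkℚ m | ℕ→ℚ≡mkℚ n = cong (ℚ._/ 1) (ℤₚ.pos-* m n)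

ℕ→ℚ-suc : ∀ n → ℕ→ℚ (suc n) ≡ ℕ→ℚ n + 1ℚ
ℕ→ℚ-suc n = trans (cong ℕ→ℚ (ℕₚ.+-comm 1 n)) (ℕ→ℚ-+ n 1)

ℕ→ℚ-suc-* : ∀ n q → ℕ→ℚ (suc n) * q ≡ ℕ→ℚ n * q + q
ℕ→ℚ-suc-* n q = begin
  ℕ→ℚ (suc n) * q       ≡⟨ cong (_* q) (ℕ→ℚ-suc n) ⟩
  (ℕ→ℚ n + 1ℚ) * q      ≡⟨ ℚₚ.*-distribʳ-+ q (ℕ→ℚ n) 1ℚ ⟩
  ℕ→ℚ n * q + 1ℚ * q    ≡⟨ cong (_+_ (ℕ→ℚ n * q)) (ℚₚ.*-identityˡ q) ⟩
  ℕ→ℚ n * q + q         ∎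
  where open ≡-Reasoning

ℕ→ℚ-≢0 : ∀ {n} → n ≢ 0 → ℕ→ℚ n ≢ 0ℚ
ℕ→ℚ-≢0 {zero}  n≢0 _ = n≢0 refl
ℕ→ℚ-≢0 {suc n} _   e with trans (sym (ℕ→ℚ≡mkℚ (suc n))) e
... | ()

ℕ→ℚ-suc≢0 : ∀ n → ℕ→ℚ (suc n) ≢ 0ℚ
ℕ→ℚ-suc≢0 n = ℕ→ℚ-≢0 {suc n} (λ ())

ℕ→ℚ-!≢0 : ∀ n → ℕ→ℚ (n !) ≢ 0ℚ
ℕ→ℚ-!≢0 n = ℕ→ℚ-≢0 (ℕ.≢-nonZero⁻¹ (n !) {{n ℕₚ.!≢0}})

inv-inverseʳ : ∀ {q} → q ≢ 0ℚ → q * inv q ≡ 1ℚ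
inv-inverseʳ {q} q≢0 with q ℚ.≟ 0ℚ
... | yes q≡0 = ⊥-elim (q≢0 q≡0)
... | no  q≢0 = ℚₚ.*-inverseʳ q {{ℚ.≢-nonZero q≢0}}

inv-inverseˡ : ∀ {q} → q ≢ 0ℚ → inv q * q ≡ 1ℚ
inv-inverseˡ {q} q≢0 = trans (ℚₚ.*-comm (inv q) q) (inv-inverseʳ q≢0)

inv-cancelˡ : ∀ {q} p → q ≢ 0ℚ → inv q * (q * p) ≡ p
inv-cancelˡ {q} p q≢0 = begin
  inv q * (q * p)  ≡⟨ ℚₚ.*-assoc (inv q) q p ⟨
  inv q * q * p    ≡⟨ cong (_* p) (inv-inverseˡ q≢0) ⟩
  1ℚ * p           ≡⟨ ℚₚ.*-identityˡ p ⟩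
  p                ∎
  where open ≡-Reasoning

inv-unique : ∀ {p q} → p * q ≡ 1ℚ → inv p ≡ q
inv-unique {p} {q} pq≡1 = begin
  inv p            ≡⟨ ℚₚ.*-identityʳ (inv p) ⟨
  inv p * 1ℚ       ≡⟨ cong (inv p *_) pq≡1 ⟨
  inv p * (p * q)  ≡⟨ inv-cancelˡ q p≢0 ⟩
  q                ∎
  where
  open ≡-Reasoning
  p≢0 : p ≢ 0ℚ
  p≢0 p≡0 = ℚₚ.1≢0 (trans (sym pq≡1) (trans (cong (_* q) p≡0) (ℚₚ.*-zeroˡ q)))

*-≢0 : ∀ {p q} → p ≢ 0ℚ → q ≢ 0ℚ → p * q ≢ 0ℚ
*-≢0 {p} {q} p≢0 q≢0 pq≡0 = p≢0 (begin
  p                ≡⟨ ℚₚ.*-identityʳ p ⟨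
  p * 1ℚ           ≡⟨ cong (p *_) (inv-inverseʳ q≢0) ⟨
  p * (q * inv q)  ≡⟨ ℚₚ.*-assoc p q (inv q) ⟨
  p * q * inv q    ≡⟨ cong (_* inv q) pq≡0 ⟩
  0ℚ * inv q       ≡⟨ ℚₚ.*-zeroˡ (inv q) ⟩
  0ℚ               ∎)
  where open ≡-Reasoning

inv-≢0 : ∀ {q} → q ≢ 0ℚ → inv q ≢ 0ℚ
inv-≢0 {q} q≢0 inv≡0 =
  ℚₚ.1≢0 (trans (sym (inv-inverseʳ q≢0)) (trans (cong (q *_) inv≡0) (ℚₚ.*-zeroʳ q)))

inv-distrib-* : ∀ {p q} → p ≢ 0ℚ → q ≢ 0ℚ → inv (p * q) ≡ inv p * inv q
inv-distrib-* {p} {q} p≢0 q≢0 = inv-unique {p * q} (begin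
  p * q * (inv p * inv q)
    ≡⟨ solve 4 (λ p q p⁻¹ q⁻¹ → p :* q :* (p⁻¹ :* q⁻¹) := p :* p⁻¹ :* (q :* q⁻¹))
               refl p q (inv p) (inv q) ⟩
  p * inv p * (q * inv q)  ≡⟨ cong₂ _*_ (inv-inverseʳ p≢0) (inv-inverseʳ q≢0) ⟩
  1ℚ                       ∎)
  where open ≡-Reasoning

^ℕ-≢0 : ∀ {a} → a ≢ 0ℚ → ∀ n → a ^ℕ n ≢ 0ℚ
^ℕ-≢0 a≢0 zero    = ℚₚ.1≢0
^ℕ-≢0 a≢0 (suc n) = *-≢0 a≢0 (^ℕ-≢0 a≢0 n)

^ℤ-≢0 : ∀ {a} → a ≢ 0ℚ → ∀ k → a ^ℤ k ≢ 0ℚ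
^ℤ-≢0 a≢0 (+ n)    = ^ℕ-≢0 a≢0 n
^ℤ-≢0 a≢0 -[1+ n ] = inv-≢0 (^ℕ-≢0 a≢0 (suc n))

^ℤ-pred : ∀ {a} → a ≢ 0ℚ → ∀ k → a ^ℤ k ≡ a * a ^ℤ (k - + 1)
^ℤ-pred {a} a≢0 (+ zero) =
  sym (trans (cong (λ b → a * inv b) (ℚₚ.*-identityʳ a)) (inv-inverseʳ a≢0))
^ℤ-pred {a} a≢0 (+ suc n) = refl
^ℤ-pred {a} a≢0 -[1+ n ] rewrite ℕₚ.+-identityʳ n = begin
  inv aⁿ⁺¹                ≡⟨ inv-cancelˡ (inv aⁿ⁺¹) a≢0 ⟨
  inv a * (a * inv aⁿ⁺¹)
    ≡⟨ solve 3 (λ a⁻¹ a b → a⁻¹ :* (a :* b) := a :* (a⁻¹ :* b)) refl (inv a) a (inv aⁿ⁺¹) ⟩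
  a * (inv a * inv aⁿ⁺¹)  ≡⟨ cong (a *_) (inv-distrib-* a≢0 (^ℕ-≢0 a≢0 (suc n))) ⟨
  a * inv (a * aⁿ⁺¹)      ∎
  where
  open ≡-Reasoning
  aⁿ⁺¹ : ℚ
  aⁿ⁺¹ = a ^ℕ suc n

∑ : ℕ → (ℕ → ℚ) → ℚ
∑ zero    f = 0ℚ
∑ (suc n) f = f 0 + ∑ n (λ i → f (suc i))

syntax ∑ n (λ i → e) = ∑[ i < n ] e

sum-map-applyUpTo : ∀ (f : ℕ → ℚ) (g : ℕ → ℕ) n →
  sum (map f (applyUpTo g n)) ≡ ∑[ i < n ] f (g i)
sum-map-applyUpTo f g zero    = refl
sum-map-applyUpTo f g (suc n) = cong (_+_ (f (g 0))) (sum-map-applyUpTo f (λ i → g (suc i)) n)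

sumFromTo≡∑ : ∀ a b f → sumFromTo a b f ≡ ∑[ i < suc b ∸ a ] f (a ℕ.+ i)
sumFromTo≡∑ a b f = sum-map-applyUpTo (λ i → f (a ℕ.+ i)) (λ i → i) (suc b ∸ a)

∑-cong : ∀ n {f g : ℕ → ℚ} → f ≗ g → ∑ n f ≡ ∑ n g
∑-cong zero    f≗g = refl
∑-cong (suc n) f≗g = cong₂ _+_ (f≗g 0) (∑-cong n (λ i → f≗g (suc i)))

∑-cong-< : ∀ n {f g : ℕ → ℚ} → (∀ {i} → i < n → f i ≡ g i) → ∑ n f ≡ ∑ n g
∑-cong-< zero    f≡g = refl
∑-cong-< (suc n) f≡g = cong₂ _+_ (f≡g (s≤s z≤n)) (∑-cong-< n (λ i<n → f≡g (s≤s i<n)))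

∑-zero : ∀ n → ∑[ i < n ] 0ℚ ≡ 0ℚ
∑-zero zero    = refl
∑-zero (suc n) = trans (ℚₚ.+-identityˡ _) (∑-zero n)

∑-distrib-+ : ∀ n (f g : ℕ → ℚ) → ∑[ i < n ] (f i + g i) ≡ ∑ n f + ∑ n g
∑-distrib-+ zero    f g = refl
∑-distrib-+ (suc n) f g =
  trans (cong (_+_ (f 0 + g 0)) (∑-distrib-+ n (λ i → f (suc i)) (λ i → g (suc i))))
        (solve 4 (λ a b c d → a :+ b :+ (c :+ d) := a :+ c :+ (b :+ d)) refl (f 0) (g 0) _ _)

*-distribˡ-∑ : ∀ n c (f : ℕ → ℚ) → c * ∑ n f ≡ ∑[ i < n ] (c * f i)
*-distribˡ-∑ zero    c f = ℚₚ.*-zeroʳ c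
*-distribˡ-∑ (suc n) c f =
  trans (ℚₚ.*-distribˡ-+ c (f 0) _) (cong (_+_ (c * f 0)) (*-distribˡ-∑ n c (λ i → f (suc i))))

*-distribˡ-∑² : ∀ n c (f : ℕ → ℕ → ℚ) →
  c * ∑[ m < n ] ∑[ j < suc m ] f m j ≡ ∑[ m < n ] ∑[ j < suc m ] (c * f m j)
*-distribˡ-∑² n c f = trans (*-distribˡ-∑ n c _) (∑-cong n λ m → *-distribˡ-∑ (suc m) c (f m))

∑-sucʳ : ∀ n f → ∑ (suc n) f ≡ ∑ n f + f n
∑-sucʳ zero    f = trans (ℚₚ.+-identityʳ (f 0)) (sym (ℚₚ.+-identityˡ (f 0)))
∑-sucʳ (suc n) f =
  trans (cong (_+_ (f 0)) (∑-sucʳ n (λ i → f (suc i)))) (sym (ℚₚ.+-assoc (f 0) _ _))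

∑-comm : ∀ m n (f : ℕ → ℕ → ℚ) → ∑[ i < m ] ∑[ j < n ] f i j ≡ ∑[ j < n ] ∑[ i < m ] f i j
∑-comm zero    n f = sym (∑-zero n)
∑-comm (suc m) n f = begin
  ∑ n (f 0) + ∑[ i < m ] ∑ n (f (suc i))
    ≡⟨ cong (_+_ (∑ n (f 0))) (∑-comm m n (λ i → f (suc i))) ⟩
  ∑ n (f 0) + ∑[ j < n ] ∑[ i < m ] f (suc i) j  ≡⟨ ∑-distrib-+ n (f 0) _ ⟨
  ∑[ j < n ] (f 0 j + ∑[ i < m ] f (suc i) j)    ∎
  where open ≡-Reasoning

sumFromTo³≡∑³ : ∀ n x (T : ℕ → ℕ → ℕ → ℚ) →
  sumFromTo 1 n (λ m → sumFromTo 1 m (λ j → sumFromTo 0 x (λ i → T m j i)))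
    ≡ ∑[ m < n ] ∑[ j < suc m ] ∑[ i < suc x ] T (suc m) (suc j) i
sumFromTo³≡∑³ n x T =
  trans (sumFromTo≡∑ 1 n (λ m → sumFromTo 1 m (λ j → sumFromTo 0 x (T m j)))) (∑-cong n λ m →
    trans (sumFromTo≡∑ 1 (suc m) (λ j → sumFromTo 0 x (T (suc m) j)))
          (∑-cong (suc m) λ j → sumFromTo≡∑ 0 x (T (suc m) (suc j))))

alternating-telescoping : ∀ (G : ℕ → ℚ) n →
  sgn n * G (suc n) + G 0 ≡ ∑[ i < suc n ] (sgn i * (G (suc i) + G i))
alternating-telescoping G zero =
  solve 2 (λ g₁ g₀ → con 1ℚ :* g₁ :+ g₀ := con 1ℚ :* (g₁ :+ g₀) :+ con 0ℚ) refl (G 1) (G 0)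
alternating-telescoping G (suc n) = begin
  sgn (suc n) * G (2+n) + G 0
    ≡⟨ solve 4 (λ s g₂ g₁ g₀ → (:- con 1ℚ :* s) :* g₂ :+ g₀
                              := s :* g₁ :+ g₀ :+ (:- con 1ℚ :* s) :* (g₂ :+ g₁))
               refl (sgn n) (G (2+n)) (G (suc n)) (G 0) ⟩
  sgn n * G (suc n) + G 0 + F (suc n)  ≡⟨ cong (_+ F (suc n)) (alternating-telescoping G n) ⟩
  ∑ (suc n) F + F (suc n)              ≡⟨ ∑-sucʳ (suc n) F ⟨
  ∑ (suc (suc n)) F                    ∎
  where
  open ≡-Reasoning
  2+n : ℕ
  2+n = suc (suc n)
  F : ℕ → ℚ
  F i = sgn i * (G (suc i) + G i)

-- Formal power series

_⊕_ : Series → Series → Series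
(f ⊕ g) n = f n + g n

shift : Series → Series
shift f n = f (suc n)

module ≗-Reasoning = SetoidReasoning (ℕ →-setoid ℚ)

⊕-cong : ∀ {f f′ g g′ : Series} → f ≗ f′ → g ≗ g′ → f ⊕ g ≗ f′ ⊕ g′
⊕-cong f≗f′ g≗g′ n = cong₂ _+_ (f≗f′ n) (g≗g′ n)

⊛-def : ∀ f g n → (f ⊛ g) n ≡ ∑[ i < suc n ] (f i * g (n ∸ i))
⊛-def f g n = sumFromTo≡∑ 0 n (λ i → f i * g (n ∸ i))

⊛-suc : ∀ f g n → (f ⊛ g) (suc n) ≡ f 0 * g (suc n) + (shift f ⊛ g) n
⊛-suc f g n =
  trans (⊛-def f g (suc n)) (cong (_+_ (f 0 * g (suc n))) (sym (⊛-def (shift f) g n)))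

⊛-sucʳ : ∀ f g n → (f ⊛ g) (suc n) ≡ (f ⊛ shift g) n + f (suc n) * g 0
⊛-sucʳ f g zero =
  solve 2 (λ a b → a :+ (b :+ con 0ℚ) := a :+ con 0ℚ :+ b) refl (f 0 * g 1) (f 1 * g 0)
⊛-sucʳ f g (suc n) = begin
  (f ⊛ g) (suc (suc n))                    ≡⟨ ⊛-suc f g (suc n) ⟩
  a + (shift f ⊛ g) (suc n)                ≡⟨ cong (_+_ a) (⊛-sucʳ (shift f) g n) ⟩
  a + ((shift f ⊛ shift g) n + r)          ≡⟨ ℚₚ.+-assoc a ((shift f ⊛ shift g) n) r ⟨
  a + (shift f ⊛ shift g) n + r            ≡⟨ cong (_+ r) (⊛-suc f (shift g) n) ⟨
  (f ⊛ shift g) (suc n) + r                ∎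
  where
  open ≡-Reasoning
  a r : ℚ
  a = f 0 * g (suc (suc n))
  r = f (suc (suc n)) * g 0

⊛-cong : ∀ {f f′ g g′ : Series} → f ≗ f′ → g ≗ g′ → f ⊛ g ≗ f′ ⊛ g′
⊛-cong f≗f′ g≗g′ n =
  cong sum (List.map-cong (λ i → cong₂ _*_ (f≗f′ i) (g≗g′ (n ∸ i))) (upTo (suc n)))

⊛-congˡ : ∀ {f f′ g : Series} → f ≗ f′ → f ⊛ g ≗ f′ ⊛ g
⊛-congˡ {g = g} f≗f′ = ⊛-cong {g = g} f≗f′ (λ _ → refl)

⊛-congʳ : ∀ {f g g′ : Series} → g ≗ g′ → f ⊛ g ≗ f ⊛ g′
⊛-congʳ {f} g≗g′ = ⊛-cong {f} (λ _ → refl) g≗g′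

⊛-comm : ∀ f g → f ⊛ g ≗ g ⊛ f
⊛-comm f g zero    = cong (_+ 0ℚ) (ℚₚ.*-comm (f 0) (g 0))
⊛-comm f g (suc n) = begin
  (f ⊛ g) (suc n)                    ≡⟨ ⊛-suc f g n ⟩
  f 0 * g (suc n) + (shift f ⊛ g) n
    ≡⟨ cong₂ _+_ (ℚₚ.*-comm (f 0) (g (suc n))) (⊛-comm (shift f) g n) ⟩
  g (suc n) * f 0 + (g ⊛ shift f) n  ≡⟨ ℚₚ.+-comm (g (suc n) * f 0) ((g ⊛ shift f) n) ⟩
  (g ⊛ shift f) n + g (suc n) * f 0  ≡⟨ ⊛-sucʳ g f n ⟨
  (g ⊛ f) (suc n)                    ∎
  where open ≡-Reasoning

⊛-distribˡ-⊕ : ∀ f g h → f ⊛ (g ⊕ h) ≗ (f ⊛ g) ⊕ (f ⊛ h)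
⊛-distribˡ-⊕ f g h n = begin
  (f ⊛ (g ⊕ h)) n                                  ≡⟨ ⊛-def f (g ⊕ h) n ⟩
  ∑[ i < suc n ] (f i * (g (n ∸ i) + h (n ∸ i)))
    ≡⟨ ∑-cong (suc n) (λ i → ℚₚ.*-distribˡ-+ (f i) (g (n ∸ i)) (h (n ∸ i))) ⟩
  ∑[ i < suc n ] (f i * g (n ∸ i) + f i * h (n ∸ i))
    ≡⟨ ∑-distrib-+ (suc n) (λ i → f i * g (n ∸ i)) (λ i → f i * h (n ∸ i)) ⟩
  ∑[ i < suc n ] (f i * g (n ∸ i)) + ∑[ i < suc n ] (f i * h (n ∸ i))
    ≡⟨ cong₂ _+_ (⊛-def f g n) (⊛-def f h n) ⟨
  (f ⊛ g) n + (f ⊛ h) n                            ∎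
  where open ≡-Reasoning

⊛-distribʳ-⊕ : ∀ f g h → (f ⊕ g) ⊛ h ≗ (f ⊛ h) ⊕ (g ⊛ h)
⊛-distribʳ-⊕ f g h n =
  trans (⊛-comm (f ⊕ g) h n)
        (trans (⊛-distribˡ-⊕ h f g n) (cong₂ _+_ (⊛-comm h f n) (⊛-comm h g n)))

⊛-scaleʳ : ∀ c f g → f ⊛ scaleS c g ≗ scaleS c (f ⊛ g)
⊛-scaleʳ c f g n = begin
  (f ⊛ scaleS c g) n                      ≡⟨ ⊛-def f (scaleS c g) n ⟩
  ∑[ i < suc n ] (f i * (c * g (n ∸ i)))
    ≡⟨ ∑-cong (suc n) (λ i → solve 3 (λ a b c → a :* (c :* b) := c :* (a :* b))
                                     refl (f i) (g (n ∸ i)) c) ⟩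
  ∑[ i < suc n ] (c * (f i * g (n ∸ i)))  ≡⟨ *-distribˡ-∑ (suc n) c (λ i → f i * g (n ∸ i)) ⟨
  c * ∑[ i < suc n ] (f i * g (n ∸ i))    ≡⟨ cong (c *_) (⊛-def f g n) ⟨
  c * (f ⊛ g) n                           ∎
  where open ≡-Reasoning

⊛-scaleˡ : ∀ c f g → scaleS c f ⊛ g ≗ scaleS c (f ⊛ g)
⊛-scaleˡ c f g n =
  trans (⊛-comm (scaleS c f) g n) (trans (⊛-scaleʳ c g f n) (cong (c *_) (⊛-comm g f n)))

⊛-zeroˡ : ∀ g → (λ _ → 0ℚ) ⊛ g ≗ (λ _ → 0ℚ)
⊛-zeroˡ g n =
  trans (⊛-def (λ _ → 0ℚ) g n)
        (trans (∑-cong (suc n) (λ i → ℚₚ.*-zeroˡ (g (n ∸ i)))) (∑-zero (suc n)))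

⊛-identityˡ : ∀ g → oneS ⊛ g ≗ g
⊛-identityˡ g zero    = trans (ℚₚ.+-identityʳ _) (ℚₚ.*-identityˡ (g 0))
⊛-identityˡ g (suc n) =
  trans (⊛-suc oneS g n)
        (trans (cong₂ _+_ (ℚₚ.*-identityˡ (g (suc n))) (⊛-zeroˡ g n)) (ℚₚ.+-identityʳ _))

⊛-identityʳ : ∀ g → g ⊛ oneS ≗ g
⊛-identityʳ g n = trans (⊛-comm g oneS n) (⊛-identityˡ g n)

⊛-assoc : ∀ f g h → (f ⊛ g) ⊛ h ≗ f ⊛ (g ⊛ h)
⊛-assoc f g h zero =
  solve 3 (λ a b c → (a :* b :+ con 0ℚ) :* c :+ con 0ℚ := a :* (b :* c :+ con 0ℚ) :+ con 0ℚ)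
        refl (f 0) (g 0) (h 0)
⊛-assoc f g h (suc n) = begin
  ((f ⊛ g) ⊛ h) (suc n)                                   ≡⟨ ⊛-suc (f ⊛ g) h n ⟩
  a + (shift (f ⊛ g) ⊛ h) n
    ≡⟨ cong (_+_ a) (trans (⊛-congˡ {g = h} (⊛-suc f g) n)
                           (⊛-distribʳ-⊕ (scaleS (f 0) (shift g)) (shift f ⊛ g) h n)) ⟩
  a + ((scaleS (f 0) (shift g) ⊛ h) n + ((shift f ⊛ g) ⊛ h) n)
    ≡⟨ cong₂ (λ u v → a + (u + v)) (⊛-scaleˡ (f 0) (shift g) h n) (⊛-assoc (shift f) g h n) ⟩
  (f 0 * g 0 + 0ℚ) * h (suc n) + (f 0 * (shift g ⊛ h) n + r)
    ≡⟨ solve 5 (λ a b c d e → (a :* b :+ con 0ℚ) :* c :+ (a :* d :+ e) := a :* (b :* c :+ d) :+ e)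
               refl (f 0) (g 0) (h (suc n)) ((shift g ⊛ h) n) r ⟩
  f 0 * (g 0 * h (suc n) + (shift g ⊛ h) n) + r  ≡⟨ cong (λ u → f 0 * u + r) (⊛-suc g h n) ⟨
  f 0 * (g ⊛ h) (suc n) + r                      ≡⟨ ⊛-suc f (g ⊛ h) n ⟨
  (f ⊛ (g ⊛ h)) (suc n)                          ∎
  where
  open ≡-Reasoning
  a r : ℚ
  a = (f ⊛ g) 0 * h (suc n)
  r = (shift f ⊛ (g ⊛ h)) n

invList≡map-invS : ∀ h n → invList h n ≡ map (λ i → invS h (n ∸ i)) (upTo (suc n))
invList≡map-invS h zero    = refl
invList≡map-invS h (suc n) = cong (invS h (suc n) ∷_) (begin
  invList h n                                             ≡⟨ invList≡map-invS h n ⟩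
  map (λ i → invS h (n ∸ i)) (upTo (suc n))               ≡⟨ List.map-applyUpTo (λ i → i) _ (suc n) ⟩
  applyUpTo (λ i → invS h (n ∸ i)) (suc n)                ≡⟨ List.map-applyUpTo suc _ (suc n) ⟨
  map (λ i → invS h (suc n ∸ i)) (applyUpTo suc (suc n))  ∎)
  where open ≡-Reasoning

zipWith-map≡map : ∀ (f g : ℕ → ℚ) xs →
  zipWith _*_ (map f xs) (map g xs) ≡ map (λ i → f i * g i) xs
zipWith-map≡map f g []       = refl
zipWith-map≡map f g (x ∷ xs) = cong (f x * g x ∷_) (zipWith-map≡map f g xs)

invS-suc : ∀ h n → invS h (suc n) ≡ - (inv (h 0) * (shift h ⊛ invS h) n)
invS-suc h n = cong (λ s → - (inv (h 0) * sum s)) (begin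
  zipWith _*_ (map (shift h) (upTo (suc n))) (invList h n)
    ≡⟨ cong (zipWith _*_ (map (shift h) (upTo (suc n)))) (invList≡map-invS h n) ⟩
  zipWith _*_ (map (shift h) (upTo (suc n))) (map (λ i → invS h (n ∸ i)) (upTo (suc n)))
    ≡⟨ zipWith-map≡map (shift h) (λ i → invS h (n ∸ i)) (upTo (suc n)) ⟩
  map (λ i → h (suc i) * invS h (n ∸ i)) (upTo (suc n))  ∎)
  where open ≡-Reasoning

⊛-invS : ∀ h → h 0 ≢ 0ℚ → h ⊛ invS h ≗ oneS
⊛-invS h h₀≢0 zero    = trans (ℚₚ.+-identityʳ _) (inv-inverseʳ h₀≢0)
⊛-invS h h₀≢0 (suc n) = begin
  (h ⊛ invS h) (suc n)            ≡⟨ ⊛-suc h (invS h) n ⟩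
  h 0 * invS h (suc n) + s        ≡⟨ cong (λ u → h 0 * u + s) (invS-suc h n) ⟩
  h 0 * - (inv (h 0) * s) + s
    ≡⟨ solve 3 (λ a a⁻¹ s → a :* (:- (a⁻¹ :* s)) :+ s := (con 1ℚ :- a :* a⁻¹) :* s)
               refl (h 0) (inv (h 0)) s ⟩
  (1ℚ + - (h 0 * inv (h 0))) * s  ≡⟨ cong (λ u → (1ℚ + - u) * s) (inv-inverseʳ h₀≢0) ⟩
  (1ℚ + - 1ℚ) * s                 ≡⟨ ℚₚ.*-zeroˡ s ⟩
  0ℚ                              ∎
  where
  open ≡-Reasoning
  s : ℚ
  s = (shift h ⊛ invS h) n

-- The exponential series

-- θ is the Euler operator t d/dt.
θ : Series → Series
θ f n = ℕ→ℚ n * f n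

t·_ : Series → Series
(t· f) zero    = 0ℚ
(t· f) (suc n) = f n

shift-θ : ∀ f → shift (θ f) ≗ θ (shift f) ⊕ shift f
shift-θ f n = ℕ→ℚ-suc-* n (f (suc n))

θ-⊛ : ∀ f g → θ (f ⊛ g) ≗ (θ f ⊛ g) ⊕ (f ⊛ θ g)
θ-⊛ f g zero =
  solve 2 (λ a b → con 0ℚ :* (a :* b :+ con 0ℚ)
                   := con 0ℚ :* a :* b :+ con 0ℚ :+ (a :* (con 0ℚ :* b) :+ con 0ℚ))
        refl (f 0) (g 0)
θ-⊛ f g (suc n) = begin
  ℕ→ℚ (suc n) * (f ⊛ g) (suc n)              ≡⟨ cong (ℕ→ℚ (suc n) *_) (⊛-suc f g n) ⟩
  ℕ→ℚ (suc n) * (f 0 * g (suc n) + s)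
    ≡⟨ solve 4 (λ a b c d → a :* (b :* c :+ d) := b :* (a :* c) :+ a :* d)
               refl (ℕ→ℚ (suc n)) (f 0) (g (suc n)) s ⟩
  a + ℕ→ℚ (suc n) * s                        ≡⟨ cong (_+_ a) (ℕ→ℚ-suc-* n s) ⟩
  a + (θ (shift f ⊛ g) n + s)                ≡⟨ cong (λ u → a + (u + s)) (θ-⊛ (shift f) g n) ⟩
  a + ((θ (shift f) ⊛ g) n + b + s)
    ≡⟨ solve 6 (λ a b c e f₀ g₁ → a :+ (c :+ b :+ e) := con 0ℚ :* f₀ :* g₁ :+ (c :+ e) :+ (a :+ b))
               refl a b ((θ (shift f) ⊛ g) n) s (f 0) (g (suc n)) ⟩
  θ f 0 * g (suc n) + ((θ (shift f) ⊛ g) n + s) + (a + b)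
    ≡⟨ cong₂ _+_ θf⊛g (⊛-suc f (θ g) n) ⟨
  (θ f ⊛ g) (suc n) + (f ⊛ θ g) (suc n)      ∎
  where
  open ≡-Reasoning
  s a b : ℚ
  s = (shift f ⊛ g) n
  a = f 0 * θ g (suc n)
  b = (shift f ⊛ θ g) n
  θf⊛g : (θ f ⊛ g) (suc n) ≡ θ f 0 * g (suc n) + ((θ (shift f) ⊛ g) n + s)
  θf⊛g = trans (⊛-suc (θ f) g n)
    (cong (_+_ (θ f 0 * g (suc n)))
          (trans (⊛-congˡ {g = g} (shift-θ f) n) (⊛-distribʳ-⊕ (θ (shift f)) (shift f) g n)))

t·-cong : ∀ {f g} → f ≗ g → t· f ≗ t· g
t·-cong f≗g zero    = refl
t·-cong f≗g (suc n) = f≗g n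

⊛-t·ˡ : ∀ f g → (t· f) ⊛ g ≗ t· (f ⊛ g)
⊛-t·ˡ f g zero    = trans (ℚₚ.+-identityʳ _) (ℚₚ.*-zeroˡ (g 0))
⊛-t·ˡ f g (suc n) =
  trans (⊛-suc (t· f) g n)
        (trans (cong (_+ (f ⊛ g) n) (ℚₚ.*-zeroˡ (g (suc n)))) (ℚₚ.+-identityˡ _))

⊛-t·ʳ : ∀ f g → f ⊛ (t· g) ≗ t· (f ⊛ g)
⊛-t·ʳ f g n = trans (⊛-comm f (t· g) n) (trans (⊛-t·ˡ g f n) (t·-cong (⊛-comm g f) n))

inv-!-suc : ∀ n → inv (ℕ→ℚ (suc n !)) ≡ inv (ℕ→ℚ (suc n)) * inv (ℕ→ℚ (n !))
inv-!-suc n = trans (cong inv (ℕ→ℚ-* (suc n) (n !))) (inv-distrib-* (ℕ→ℚ-suc≢0 n) (ℕ→ℚ-!≢0 n))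

θ-expS : ∀ c → θ (expS c) ≗ scaleS c (t· expS c)
θ-expS c zero    = trans (ℚₚ.*-zeroˡ (expS c 0)) (sym (ℚₚ.*-zeroʳ c))
θ-expS c (suc n) = begin
  s * (c * cⁿ * inv (ℕ→ℚ (suc n !)))  ≡⟨ cong (λ u → s * (c * cⁿ * u)) (inv-!-suc n) ⟩
  s * (c * cⁿ * (inv s * n!⁻¹))
    ≡⟨ solve 5 (λ s c p s⁻¹ f → s :* (c :* p :* (s⁻¹ :* f)) := s⁻¹ :* (s :* (c :* (p :* f))))
               refl s c cⁿ (inv s) n!⁻¹ ⟩
  inv s * (s * (c * (cⁿ * n!⁻¹)))     ≡⟨ inv-cancelˡ (c * (cⁿ * n!⁻¹)) (ℕ→ℚ-suc≢0 n) ⟩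
  c * (cⁿ * n!⁻¹)                     ∎
  where
  open ≡-Reasoning
  s cⁿ n!⁻¹ : ℚ
  s    = ℕ→ℚ (suc n)
  cⁿ   = c ^ℕ n
  n!⁻¹ = inv (ℕ→ℚ (n !))

expS-unique : ∀ c (a : Series) → a 0 ≡ 1ℚ → θ a ≗ scaleS c (t· a) → a ≗ expS c
expS-unique c a a₀≡1 θa≗ca zero    = a₀≡1
expS-unique c a a₀≡1 θa≗ca (suc n) = begin
  a (suc n)                      ≡⟨ inv-cancelˡ (a (suc n)) (ℕ→ℚ-suc≢0 n) ⟨
  inv s * (s * a (suc n))        ≡⟨ cong (inv s *_) (θa≗ca (suc n)) ⟩
  inv s * (c * a n)              ≡⟨ cong (λ u → inv s * (c * u)) (expS-unique c a a₀≡1 θa≗ca n) ⟩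
  inv s * (c * (c ^ℕ n * n!⁻¹))
    ≡⟨ solve 4 (λ s⁻¹ c p f → s⁻¹ :* (c :* (p :* f)) := c :* p :* (s⁻¹ :* f))
               refl (inv s) c (c ^ℕ n) n!⁻¹ ⟩
  c * c ^ℕ n * (inv s * n!⁻¹)    ≡⟨ cong (c * c ^ℕ n *_) (inv-!-suc n) ⟨
  expS c (suc n)                 ∎
  where
  open ≡-Reasoning
  s n!⁻¹ : ℚ
  s    = ℕ→ℚ (suc n)
  n!⁻¹ = inv (ℕ→ℚ (n !))

expS-+ : ∀ x y → expS x ⊛ expS y ≗ expS (x + y)
expS-+ x y = expS-unique (x + y) (eˣ ⊛ eʸ) refl θ[eˣ⊛eʸ]
  where
  eˣ eʸ : Series
  eˣ = expS x
  eʸ = expS y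
  θ[eˣ⊛eʸ] : θ (eˣ ⊛ eʸ) ≗ scaleS (x + y) (t· (eˣ ⊛ eʸ))
  θ[eˣ⊛eʸ] n = begin
    θ (eˣ ⊛ eʸ) n                                  ≡⟨ θ-⊛ eˣ eʸ n ⟩
    (θ eˣ ⊛ eʸ) n + (eˣ ⊛ θ eʸ) n
      ≡⟨ cong₂ _+_ (⊛-congˡ {g = eʸ} (θ-expS x) n) (⊛-congʳ {eˣ} (θ-expS y) n) ⟩
    (scaleS x (t· eˣ) ⊛ eʸ) n + (eˣ ⊛ scaleS y (t· eʸ)) n
      ≡⟨ cong₂ _+_ (⊛-scaleˡ x (t· eˣ) eʸ n) (⊛-scaleʳ y eˣ (t· eʸ) n) ⟩
    x * ((t· eˣ) ⊛ eʸ) n + y * (eˣ ⊛ (t· eʸ)) n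
      ≡⟨ cong₂ (λ u v → x * u + y * v) (⊛-t·ˡ eˣ eʸ n) (⊛-t·ʳ eˣ eʸ n) ⟩
    x * p + y * p                                  ≡⟨ ℚₚ.*-distribʳ-+ p x y ⟨
    (x + y) * p                                    ∎
    where
    open ≡-Reasoning
    p : ℚ
    p = (t· (eˣ ⊛ eʸ)) n

-- The generating function at consecutive arguments

expPlusOne₀≢0 : expPlusOne 0 ≢ 0ℚ
expPlusOne₀≢0 = ℕ→ℚ-suc≢0 1

2/[eᵗ+1]⊛[eᵗ+1] : scaleS (ℕ→ℚ 2) (invS expPlusOne) ⊛ expPlusOne ≗ scaleS (ℕ→ℚ 2) oneS
2/[eᵗ+1]⊛[eᵗ+1] n =
  trans (⊛-scaleˡ (ℕ→ℚ 2) (invS expPlusOne) expPlusOne n)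
        (cong (ℕ→ℚ 2 *_) (trans (⊛-comm (invS expPlusOne) expPlusOne n)
                                (⊛-invS expPlusOne expPlusOne₀≢0 n)))

GenocchiGF-shift : ∀ k x →
  GenocchiGF k (x + 1ℚ) ⊕ GenocchiGF k x ≗ scaleS (ℕ→ℚ 2) (EiLogS k ⊛ expS x)
GenocchiGF-shift k x = begin
  ((A ⊛ B) ⊛ expS (x + 1ℚ)) ⊕ ((A ⊛ B) ⊛ eˣ)
    ≈⟨ ⊕-cong (⊛-congʳ {A ⊛ B} (expS-+ x 1ℚ)) (⊛-congʳ {A ⊛ B} (⊛-identityʳ eˣ)) ⟨
  ((A ⊛ B) ⊛ (eˣ ⊛ expS 1ℚ)) ⊕ ((A ⊛ B) ⊛ (eˣ ⊛ oneS))
    ≈⟨ ⊛-distribˡ-⊕ (A ⊛ B) (eˣ ⊛ expS 1ℚ) (eˣ ⊛ oneS) ⟨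
  (A ⊛ B) ⊛ ((eˣ ⊛ expS 1ℚ) ⊕ (eˣ ⊛ oneS))
    ≈⟨ ⊛-congʳ {A ⊛ B} (⊛-distribˡ-⊕ eˣ (expS 1ℚ) oneS) ⟨
  (A ⊛ B) ⊛ (eˣ ⊛ expPlusOne)      ≈⟨ ⊛-assoc (A ⊛ B) eˣ expPlusOne ⟨
  ((A ⊛ B) ⊛ eˣ) ⊛ expPlusOne      ≈⟨ ⊛-comm ((A ⊛ B) ⊛ eˣ) expPlusOne ⟩
  expPlusOne ⊛ ((A ⊛ B) ⊛ eˣ)      ≈⟨ ⊛-assoc expPlusOne (A ⊛ B) eˣ ⟨
  (expPlusOne ⊛ (A ⊛ B)) ⊛ eˣ      ≈⟨ ⊛-congˡ {g = eˣ} (⊛-assoc expPlusOne A B) ⟨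
  ((expPlusOne ⊛ A) ⊛ B) ⊛ eˣ
    ≈⟨ ⊛-congˡ {g = eˣ} (⊛-congˡ {g = B} λ n →
         trans (⊛-comm expPlusOne A n) (2/[eᵗ+1]⊛[eᵗ+1] n)) ⟩
  (scaleS (ℕ→ℚ 2) oneS ⊛ B) ⊛ eˣ
    ≈⟨ ⊛-congˡ {g = eˣ} (λ n →
         trans (⊛-scaleˡ (ℕ→ℚ 2) oneS B n) (cong (ℕ→ℚ 2 *_) (⊛-identityˡ B n))) ⟩
  scaleS (ℕ→ℚ 2) B ⊛ eˣ            ≈⟨ ⊛-scaleˡ (ℕ→ℚ 2) B eˣ ⟩
  scaleS (ℕ→ℚ 2) (B ⊛ eˣ)          ∎
  where
  open ≗-Reasoning
  A B eˣ : Series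
  A  = scaleS (ℕ→ℚ 2) (invS expPlusOne)
  B  = EiLogS k
  eˣ = expS x

-- Coefficients of Ei_k(log(1+t)) e^{xt}

C*[!*!]≡! : ∀ {m n} → m ≤ n → (n C m) ℕ.* (m ! ℕ.* (n ∸ m) !) ≡ n !
C*[!*!]≡! {m} {n} m≤n =
  trans (cong (ℕ._* (m ! ℕ.* (n ∸ m) !)) (nCk≡n!/k![n-k]! m≤n))
        (m/n*n≡m {{m ℕₚ.!* (n ∸ m) !≢0}} (k![n∸k]!∣n! m≤n))

!*expS≡C*!*^ : ∀ c {m n} → m ≤ n →
  ℕ→ℚ (n !) * expS c (n ∸ m) ≡ ℕ→ℚ (n C m) * ℕ→ℚ (m !) * c ^ℕ (n ∸ m)
!*expS≡C*!*^ c {m} {n} m≤n = begin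
  ℕ→ℚ (n !) * (p * inv d)
    ≡⟨ cong (λ u → ℕ→ℚ u * (p * inv d)) (C*[!*!]≡! m≤n) ⟨
  ℕ→ℚ ((n C m) ℕ.* (m ! ℕ.* (n ∸ m) !)) * (p * inv d)
    ≡⟨ cong (_* (p * inv d)) (trans (ℕ→ℚ-* (n C m) (m ! ℕ.* (n ∸ m) !))
                                    (cong (nCm *_) (ℕ→ℚ-* (m !) ((n ∸ m) !)))) ⟩
  nCm * (M * d) * (p * inv d)
    ≡⟨ solve 5 (λ a b d p d⁻¹ → a :* (b :* d) :* (p :* d⁻¹) := a :* b :* p :* (d :* d⁻¹))
               refl nCm M d p (inv d) ⟩
  nCm * M * p * (d * inv d)  ≡⟨ cong (nCm * M * p *_) (inv-inverseʳ (ℕ→ℚ-!≢0 (n ∸ m))) ⟩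
  nCm * M * p * 1ℚ           ≡⟨ ℚₚ.*-identityʳ (nCm * M * p) ⟩
  nCm * M * p                ∎
  where
  open ≡-Reasoning
  nCm M d p : ℚ
  nCm = ℕ→ℚ (n C m)
  M = ℕ→ℚ (m !)
  d = ℕ→ℚ ((n ∸ m) !)
  p = c ^ℕ (n ∸ m)

[1+j]^k*j!≡[1+j]!*[1+j]^[k-1] : ∀ k j →
  ℕ→ℚ (suc j) ^ℤ k * ℕ→ℚ (j !) ≡ ℕ→ℚ (suc j !) * ℕ→ℚ (suc j) ^ℤ (k - + 1)
[1+j]^k*j!≡[1+j]!*[1+j]^[k-1] k j = begin
  a ^ℤ k * ℕ→ℚ (j !)  ≡⟨ cong (_* ℕ→ℚ (j !)) (^ℤ-pred (ℕ→ℚ-suc≢0 j) k) ⟩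
  a * p * ℕ→ℚ (j !)   ≡⟨ solve 3 (λ a p f → a :* p :* f := a :* f :* p) refl a p (ℕ→ℚ (j !)) ⟩
  a * ℕ→ℚ (j !) * p   ≡⟨ cong (_* p) (ℕ→ℚ-* (suc j) (j !)) ⟨
  ℕ→ℚ (suc j !) * p   ∎
  where
  open ≡-Reasoning
  a p : ℚ
  a = ℕ→ℚ (suc j)
  p = a ^ℤ (k - + 1)

expansionTerm : ℤ → ℕ → ℚ → ℕ → ℕ → ℚ
expansionTerm k n x m j = x ^ℕ (n ∸ m) * ℕ→ℚ (n C m) * (S1 m j * inv (ℕ→ℚ j ^ℤ (k - + 1)))

!*EiLog-term≡S1 : ∀ k m j →
  ℕ→ℚ (m !) * ((logS ^S suc j) m * inv (ℕ→ℚ (suc j) ^ℤ k * ℕ→ℚ (j !)))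
    ≡ S1 m (suc j) * inv (ℕ→ℚ (suc j) ^ℤ (k - + 1))
!*EiLog-term≡S1 k m j = begin
  M * (L * inv (ℕ→ℚ (suc j) ^ℤ k * ℕ→ℚ (j !)))
    ≡⟨ cong (λ u → M * (L * inv u)) ([1+j]^k*j!≡[1+j]!*[1+j]^[k-1] k j) ⟩
  M * (L * inv (J * p))
    ≡⟨ cong (λ u → M * (L * u))
            (inv-distrib-* (ℕ→ℚ-!≢0 (suc j)) (^ℤ-≢0 (ℕ→ℚ-suc≢0 j) (k - + 1))) ⟩
  M * (L * (inv J * inv p))
    ≡⟨ solve 4 (λ M L J⁻¹ p⁻¹ → M :* (L :* (J⁻¹ :* p⁻¹)) := M :* J⁻¹ :* L :* p⁻¹)
               refl M L (inv J) (inv p) ⟩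
  M * inv J * L * inv p  ∎
  where
  open ≡-Reasoning
  M L J p : ℚ
  M = ℕ→ℚ (m !)
  L = (logS ^S suc j) m
  J = ℕ→ℚ (suc j !)
  p = ℕ→ℚ (suc j) ^ℤ (k - + 1)

!*EiLogS⊛expS : ∀ k x n →
  ℕ→ℚ (n !) * (EiLogS k ⊛ expS x) n ≡ ∑[ m < n ] ∑[ j < suc m ] expansionTerm k n x (suc m) (suc j)
!*EiLogS⊛expS k x n = begin
  n! * (EiLogS k ⊛ expS x) n                    ≡⟨ cong (n! *_) (⊛-def (EiLogS k) (expS x) n) ⟩
  n! * (0ℚ * expS x n + ∑ n tᵐ)
    ≡⟨ cong (λ u → n! * (u + ∑ n tᵐ)) (ℚₚ.*-zeroˡ (expS x n)) ⟩
  n! * (0ℚ + ∑ n tᵐ)                            ≡⟨ cong (n! *_) (ℚₚ.+-identityˡ (∑ n tᵐ)) ⟩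
  n! * ∑ n tᵐ                                   ≡⟨ *-distribˡ-∑ n n! tᵐ ⟩
  ∑[ m < n ] (n! * tᵐ m)                        ≡⟨ ∑-cong-< n !*tᵐ ⟩
  ∑[ m < n ] ∑[ j < suc m ] expansionTerm k n x (suc m) (suc j)  ∎
  where
  open ≡-Reasoning
  n! : ℚ
  n! = ℕ→ℚ (n !)
  tᵐ : ℕ → ℚ
  tᵐ m = EiLogS k (suc m) * expS x (n ∸ suc m)
  !*tᵐ : ∀ {m} → m < n → n! * tᵐ m ≡ ∑[ j < suc m ] expansionTerm k n x (suc m) (suc j)
  !*tᵐ {m} m<n = begin
    n! * (EiLogS k (suc m) * e)  ≡⟨ cong (λ u → n! * (u * e)) (sumFromTo≡∑ 1 (suc m) ε) ⟩
    n! * (∑ (suc m) ε′ * e)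
      ≡⟨ solve 3 (λ a s e → a :* (s :* e) := a :* e :* s) refl n! (∑ (suc m) ε′) e ⟩
    n! * e * ∑ (suc m) ε′        ≡⟨ cong (_* ∑ (suc m) ε′) (!*expS≡C*!*^ x m<n) ⟩
    nCm * M * p * ∑ (suc m) ε′   ≡⟨ *-distribˡ-∑ (suc m) (nCm * M * p) ε′ ⟩
    ∑[ j < suc m ] (nCm * M * p * ε′ j)
      ≡⟨ ∑-cong (suc m) (λ j →
           trans (solve 4 (λ a b p x → a :* b :* p :* x := p :* a :* (b :* x)) refl nCm M p (ε′ j))
                 (cong (p * nCm *_) (!*EiLog-term≡S1 k (suc m) j))) ⟩
    ∑[ j < suc m ] expansionTerm k n x (suc m) (suc j)  ∎
    where
    nCm M p e : ℚ
    nCm = ℕ→ℚ (n C suc m)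
    M = ℕ→ℚ (suc m !)
    p = x ^ℕ (n ∸ suc m)
    e = expS x (n ∸ suc m)
    ε ε′ : ℕ → ℚ
    ε j  = (logS ^S j) (suc m) * inv (ℕ→ℚ j ^ℤ k * ℕ→ℚ ((j ∸ 1) !))
    ε′ j = ε (suc j)

polyGenocchi-shift : ∀ k n x →
  polyGenocchi k n (x + 1ℚ) + polyGenocchi k n x
    ≡ ℕ→ℚ 2 * ∑[ m < n ] ∑[ j < suc m ] expansionTerm k n x (suc m) (suc j)
polyGenocchi-shift k n x = begin
  n! * GenocchiGF k (x + 1ℚ) n + n! * GenocchiGF k x n  ≡⟨ ℚₚ.*-distribˡ-+ n! _ _ ⟨
  n! * (GenocchiGF k (x + 1ℚ) n + GenocchiGF k x n)    ≡⟨ cong (n! *_) (GenocchiGF-shift k x n) ⟩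
  n! * (ℕ→ℚ 2 * c)
    ≡⟨ solve 3 (λ a b c → a :* (b :* c) := b :* (a :* c)) refl n! (ℕ→ℚ 2) c ⟩
  ℕ→ℚ 2 * (n! * c)                                    ≡⟨ cong (ℕ→ℚ 2 *_) (!*EiLogS⊛expS k x n) ⟩
  ℕ→ℚ 2 * ∑[ m < n ] ∑[ j < suc m ] expansionTerm k n x (suc m) (suc j)  ∎
  where
  open ≡-Reasoning
  n! c : ℚ
  n! = ℕ→ℚ (n !)
  c  = (EiLogS k ⊛ expS x) n

signed-polyGenocchi-shift : ∀ k n i →
  sgn i * (polyGenocchi k n (ℕ→ℚ (suc i)) + polyGenocchi k n (ℕ→ℚ i))
    ≡ ℕ→ℚ 2 * ∑[ m < n ] ∑[ j < suc m ]
        (sgn i * (ℕ→ℚ i ^ℕ (n ∸ suc m)) * ℕ→ℚ (n C suc m)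
          * (S1 (suc m) (suc j) * inv (ℕ→ℚ (suc j) ^ℤ (k - + 1))))
signed-polyGenocchi-shift k n i = begin
  sgn i * (G (ℕ→ℚ (suc i)) + G (ℕ→ℚ i))
    ≡⟨ cong (λ y → sgn i * (G y + G (ℕ→ℚ i))) (ℕ→ℚ-suc i) ⟩
  sgn i * (G (ℕ→ℚ i + 1ℚ) + G (ℕ→ℚ i))
    ≡⟨ cong (sgn i *_) (polyGenocchi-shift k n (ℕ→ℚ i)) ⟩
  sgn i * (ℕ→ℚ 2 * ∑∑E)
    ≡⟨ solve 3 (λ a b c → a :* (b :* c) := b :* (a :* c)) refl (sgn i) (ℕ→ℚ 2) ∑∑E ⟩
  ℕ→ℚ 2 * (sgn i * ∑∑E)                   ≡⟨ cong (ℕ→ℚ 2 *_) (*-distribˡ-∑² n (sgn i) E) ⟩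
  ℕ→ℚ 2 * ∑[ m < n ] ∑[ j < suc m ] (sgn i * E m j)
    ≡⟨ cong (ℕ→ℚ 2 *_) (∑-cong n λ m → ∑-cong (suc m) λ j →
         solve 4 (λ s p c t → s :* (p :* c :* t) := s :* p :* c :* t)
                 refl (sgn i) (ℕ→ℚ i ^ℕ (n ∸ suc m)) (ℕ→ℚ (n C suc m))
                 (S1 (suc m) (suc j) * inv (ℕ→ℚ (suc j) ^ℤ (k - + 1)))) ⟩
  _                                        ∎
  where
  open ≡-Reasoning
  G : ℚ → ℚ
  G = polyGenocchi k n
  E : ℕ → ℕ → ℚ
  E m j = expansionTerm k n (ℕ→ℚ i) (suc m) (suc j)
  ∑∑E : ℚ
  ∑∑E = ∑[ m < n ] ∑[ j < suc m ] E m j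

corollary5 : (k : ℤ) (x' n' : ℕ) →
    sgn (suc x' ∸ 1) * polyEuler k (suc n' ∸ 1) (ℕ→ℚ (suc x')) + polyEulerNum k (suc n' ∸ 1)
      ≡ (ℕ→ℚ 2 * inv (ℕ→ℚ (suc n'))) *
        sumFromTo 1 (suc n') (λ m → sumFromTo 1 m (λ j → sumFromTo 0 (suc x' ∸ 1) (λ i →
          sgn i * (ℕ→ℚ i ^ℕ (suc n' ∸ m)) * ℕ→ℚ (suc n' C m)
            * (S1 m j * inv (ℕ→ℚ j ^ℤ (k - + 1))))))
corollary5 k x' n' = begin
  sgn x' * (G (suc x') * n⁻¹) + G 0 * n⁻¹
    ≡⟨ solve 4 (λ s g₁ g₀ i → s :* (g₁ :* i) :+ g₀ :* i := i :* (s :* g₁ :+ g₀))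
               refl (sgn x') (G (suc x')) (G 0) n⁻¹ ⟩
  n⁻¹ * (sgn x' * G (suc x') + G 0)                  ≡⟨ cong (n⁻¹ *_) (alternating-telescoping G x') ⟩
  n⁻¹ * ∑[ i < suc x' ] (sgn i * (G (suc i) + G i))
    ≡⟨ cong (n⁻¹ *_) (∑-cong (suc x') (signed-polyGenocchi-shift k n)) ⟩
  n⁻¹ * ∑[ i < suc x' ] (ℕ→ℚ 2 * T² i)
    ≡⟨ cong (n⁻¹ *_) (*-distribˡ-∑ (suc x') (ℕ→ℚ 2) T²) ⟨
  n⁻¹ * (ℕ→ℚ 2 * ∑ (suc x') T²)
    ≡⟨ solve 3 (λ a b c → a :* (b :* c) := b :* a :* c) refl n⁻¹ (ℕ→ℚ 2) (∑ (suc x') T²) ⟩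
  ℕ→ℚ 2 * n⁻¹ * ∑ (suc x') T²
    ≡⟨ cong (ℕ→ℚ 2 * n⁻¹ *_)
            (trans (∑-comm (suc x') n (λ i m → ∑[ j < suc m ] T (suc m) (suc j) i))
                   (∑-cong n λ m → ∑-comm (suc x') (suc m) (λ i j → T (suc m) (suc j) i))) ⟩
  ℕ→ℚ 2 * n⁻¹ * ∑[ m < n ] ∑[ j < suc m ] ∑[ i < suc x' ] T (suc m) (suc j) i
    ≡⟨ cong (ℕ→ℚ 2 * n⁻¹ *_) (sumFromTo³≡∑³ n x' T) ⟨
  ℕ→ℚ 2 * n⁻¹ * sumFromTo 1 n (λ m → sumFromTo 1 m (λ j → sumFromTo 0 x' (T m j)))  ∎
  where
  open ≡-Reasoning
  n : ℕ
  n = suc n'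
  n⁻¹ : ℚ
  n⁻¹ = inv (ℕ→ℚ n)
  G T² : ℕ → ℚ
  G i = polyGenocchi k n (ℕ→ℚ i)
  T : ℕ → ℕ → ℕ → ℚ
  T m j i = sgn i * (ℕ→ℚ i ^ℕ (n ∸ m)) * ℕ→ℚ (n C m) * (S1 m j * inv (ℕ→ℚ j ^ℤ (k - + 1)))
  T² i = ∑[ m < n ] ∑[ j < suc m ] T (suc m) (suc j) i
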